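{- For all integers $n\ge 0$ and all $k\in\{1,3\}$, \[ a_{2,k}(n)\le a_{4,k}(n). \]
   Context: A partition of $n$ is a non-increasing sequence of positive integers summing to $n$; its Young diagram is the left-justified array of boxes whose $i$-th row has $\lambda_i$ boxes. The hook length of a box is the number of boxes directly to its right, plus the number directly below it, plus $1$; a box of hook length $k$ is a $k$-hook. For $t\ge 2$, a $t$-core partition is a partition none of whose hook lengths is divisible by $t$. $a_{t,k}(n)$ denotes the total number of hooks of length $k$ summed over all $t$-core partitions of $n$. -}

module Defs where

open import Data.Nat using (ℕ; zero; suc; _+_; _∸_; _<?_; _≥?_; _≟_)
open import Data.Nat.Divisibility using (_∣_; _∣?_)
open import Data.List using (List; []; _∷_; _++_; map; concatMap; upTo; filter; length)
open import Data.Nat.ListAction using (sum)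
open import Data.List.Relation.Unary.All using (All; all?)
open import Data.List.Relation.Unary.Linked using (Linked; linked?)
open import Relation.Nullary using (¬_)
import Relation.Nullary
open import Relation.Nullary.Decidable using (¬?)

-- A partition is represented by its list of parts (λ₁, λ₂, …).

-- compositions f n : all lists of positive integers summing to n
-- (fuel f ≥ n suffices, since each part is ≥ 1).
compositions : ℕ → ℕ → List (List ℕ)
compositions _       zero    = [] ∷ []
compositions zero    (suc n) = []
compositions (suc f) (suc n) =
  concatMap (λ i → map (suc i ∷_) (compositions f (n ∸ i))) (upTo (suc n))

NonIncreasing : List ℕ → Set
NonIncreasing = Linked (λ a b → a Data.Nat.≥ b)

partitions : ℕ → List (List ℕ)
partitions n = filter (linked? (λ a b → a ≥? b)) (compositions n n)

-- Box in row r (of length r) at column j (0-indexed, j < r):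
--   boxes to its right = r ∸ (j + 1),
--   boxes below it     = number of later rows with length > j.
hooks : List ℕ → List ℕ
hooks []       = []
hooks (r ∷ rs) =
  map (λ j → (r ∸ suc j) + length (filter (λ r′ → j <? r′) rs) + 1) (upTo r)
  ++ hooks rs

IsCore : ℕ → List ℕ → Set
IsCore t λp = All (λ h → ¬ (t ∣ h)) (hooks λp)

numHooks : ℕ → List ℕ → ℕ
numHooks k λp = length (filter (λ h → h ≟ k) (hooks λp))

isCore? : (t : ℕ) → (λp : List ℕ) → Relation.Nullary.Dec (IsCore t λp)
isCore? t λp = all? (λ h → ¬? (t ∣? h)) (hooks λp)

a : ℕ → ℕ → ℕ → ℕ
a t k n = sum (map (numHooks k)
  (filter (isCore? t) (partitions n)))

{-# OPTIONS --safe #-}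
-- Every hook length divisible by 4 is divisible by 2, so every 2-core is a 4-core.
-- Hence the 2-cores of n form a sublist of the 4-cores of n, and summing the
-- (nonnegative) k-hook counts over a sublist can only make the total smaller.
module Submission where

open import Defs
open import Data.Nat using (ℕ; _≤_)
open import Data.Nat.Properties using (≤-refl; ≤-trans; m≤n+m; +-monoʳ-≤)
open import Data.Nat.Divisibility using (_∣_; ∣-trans; divides)
open import Data.Nat.ListAction using (sum)
open import Data.List using (List; map; filter)
open import Data.List.Relation.Unary.All as All using ()
open import Data.List.Relation.Binary.Sublist.Propositional using (_⊆_; []; _∷_; _∷ʳ_; ⊆-refl)
open import Data.List.Relation.Binary.Sublist.Propositional.Properties using (filter⁺; map⁺)
open import Data.Sum using (_⊎_)
open import Relation.Binary.PropositionalEquality using (_≡_; refl)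

IsCore-∣ : ∀ {t u} → t ∣ u → ∀ p → IsCore t p → IsCore u p
IsCore-∣ t∣u p = All.map (λ t∤h u∣h → t∤h (∣-trans t∣u u∣h))

sum-mono-⊆ : {ms ns : List ℕ} → ms ⊆ ns → sum ms ≤ sum ns
sum-mono-⊆ []             = ≤-refl
sum-mono-⊆ (n ∷ʳ ms⊆ns)   = ≤-trans (sum-mono-⊆ ms⊆ns) (m≤n+m _ n)
sum-mono-⊆ (refl ∷ ms⊆ns) = +-monoʳ-≤ _ (sum-mono-⊆ ms⊆ns)

cores-⊆ : ∀ {t u} → t ∣ u → (ps : List (List ℕ)) →
          filter (isCore? t) ps ⊆ filter (isCore? u) ps
cores-⊆ t∣u ps =
  filter⁺ (isCore? _) (isCore? _) (λ { {p} refl → IsCore-∣ t∣u p }) (⊆-refl {x = ps})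

a-mono-∣ : ∀ {t u} → t ∣ u → ∀ k n → a t k n ≤ a u k n
a-mono-∣ t∣u k n = sum-mono-⊆ (map⁺ (numHooks k) (cores-⊆ t∣u (partitions n)))

-- The inequality holds for every k.
theorem1p9 : (n k : ℕ) → (k ≡ 1 ⊎ k ≡ 3) → a 2 k n ≤ a 4 k n
theorem1p9 n k _ = a-mono-∣ (divides 2 refl) k n
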